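{- Let $T$ be a tree with $2 \le \gamma_{\rm SMB}'(T) <\infty$ and suppose that $s_1$ is an optimal first move of Staller in the S-game on $T$. (i) If Dominator's response is playing a vertex $d_1$ which is a neighbor of $s_1$, then Staller's optimal next move $s_2$ and $d_1$ belong to different components of $T-s_1$. (ii) After Staller's optimal move $s_1$, there exists an optimal response $d_1'$ of Dominator such that $d_1' \in N_T(s_1)$.
   Context: The Maker-Breaker domination game on a finite simple graph $G$: two players, Dominator and Staller, alternately select (claim) a previously unselected vertex of $G$. Staller wins if at some point she has claimed all vertices of the closed neighborhood $N_G[v]=N_G(v)\cup\{v\}$ of some vertex $v$; Dominator wins otherwise (i.e., if his vertices eventually form a dominating set). In the S-game Staller makes the first move. $\gamma_{\rm SMB}'(G)$ is the minimum number of moves Staller needs to win the S-game when both players play optimally, where Staller aims to win in as few of her moves as possible and Dominator aims to prevent her win or, if he cannot, to delay it as long as possible; $\gamma_{\rm SMB}'(G)=\infty$ if Staller has no winning strategy. A move is optimal if it is consistent with such optimal play. -}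

module Defs where

open import Data.Nat using (ℕ; zero; suc; _≤_; _<_)
open import Data.Fin using (Fin; _≟_)
open import Data.Bool using (Bool; true; false; _∨_)
open import Data.List using (List; _++_; take; length)
open import Data.List.Relation.Unary.Unique.Propositional using (Unique)
open import Data.List.Relation.Unary.Linked using (Linked)
open import Data.Product using (Σ; ∃; _×_; _,_)
open import Data.Sum using (_⊎_)
open import Data.Unit using (⊤)
open import Data.Empty using (⊥)
open import Relation.Nullary using (¬_; does)
open import Relation.Binary.PropositionalEquality using (_≡_; _≢_)

record Graph (n : ℕ) : Set where
  field
    E      : Fin n → Fin n → Bool
    E-sym  : ∀ u v → E u v ≡ E v u
    E-irr  : ∀ v → E v v ≡ false
open Graph public

-- A position of the game: the sets of vertices claimed by Staller / Dominator.
record Pos (n : ℕ) : Set where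
  constructor ⟨_,_⟩
  field
    St : Fin n → Bool
    Dm : Fin n → Bool
open Pos public

insert : ∀ {n} → Fin n → (Fin n → Bool) → (Fin n → Bool)
insert v S u = does (u ≟ v) ∨ S u

∅ : ∀ {n} → Fin n → Bool
∅ _ = false

start : ∀ {n} → Pos n
start = ⟨ ∅ , ∅ ⟩

playS : ∀ {n} → Fin n → Pos n → Pos n
playS v p = ⟨ insert v (St p) , Dm p ⟩

playD : ∀ {n} → Fin n → Pos n → Pos n
playD v p = ⟨ St p , insert v (Dm p) ⟩

Free : ∀ {n} → Pos n → Fin n → Set
Free p v = (St p v ≡ false) × (Dm p v ≡ false)

module _ {n : ℕ} (G : Graph n) where

  Adj : Fin n → Fin n → Set
  Adj u v = E G u v ≡ true

  InClosedNbhd : Fin n → Fin n → Set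
  InClosedNbhd v u = (u ≡ v) ⊎ Adj u v

  data Walk (P : Fin n → Set) : Fin n → Fin n → Set where
    stop : ∀ {u} → P u → Walk P u u
    step : ∀ {u w v} → P u → Adj u w → Walk P w v → Walk P u v

  Connected : Set
  Connected = ∀ u v → Walk (λ _ → ⊤) u v

  IsCycle : List (Fin n) → Set
  IsCycle cs = Unique cs × (3 ≤ length cs) × Linked Adj (cs ++ take 1 cs)

  Acyclic : Set
  Acyclic = ∀ cs → ¬ IsCycle cs

  IsTree : Set
  IsTree = Connected × Acyclic

  SameComponentWithout : Fin n → Fin n → Fin n → Set
  SameComponentWithout z x y = Walk (λ w → w ≢ z) x y

  StallerWon : Pos n → Set
  StallerWon p = ∃ λ v → ∀ u → InClosedNbhd v u → St p u ≡ true

  mutual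
    -- Staller to move: she can force a win within k more of her moves
    SWin : ℕ → Pos n → Set
    SWin zero    p = ⊥
    SWin (suc k) p = ∃ λ v → Free p v × DWin k (playS v p)

    DWin : ℕ → Pos n → Set
    DWin k p = StallerWon p
             ⊎ ((∃ λ u → Free p u) × (∀ u → Free p u → SWin k (playD u p)))

  IsSVal : Pos n → ℕ → Set
  IsSVal p m = SWin m p × (∀ j → j < m → ¬ SWin j p)

  IsDVal : Pos n → ℕ → Set
  IsDVal p m = DWin m p × (∀ j → j < m → ¬ DWin j p)

  IsGammaSMB' : ℕ → Set
  IsGammaSMB' m = IsSVal start m

  OptS : Pos n → Fin n → Set
  OptS p v = Free p v × Σ ℕ λ k → IsSVal p (suc k) × DWin k (playS v p)

  OptD : Pos n → Fin n → Set
  OptD p u = Free p u × Σ ℕ λ k → IsDVal p k × IsSVal (playD u p) k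

{-# OPTIONS --safe #-}

-- Both parts rest on a sum argument.  If the board splits into parts R and Q such that
-- every closed neighbourhood free of Dominator's vertices lies inside R or inside Q, then
-- Dominator, answering every Staller move in the part where it was made, ensures that
-- Staller wins no faster on the whole board than in one of the two parts.  In a tree, once
-- Dominator owns a neighbour x of s, the component A of x in T - s and its complement
-- split the board in this way.
-- (i) If s₂ lay in the component A of d₁, Staller would have to win either inside A,
-- where she starts from s₂ alone and so needs γ' moves, or on the rest, which is the
-- position s₁ against d₁ with one move fewer than its value; neither fits in time.
-- (ii) Let d be an optimal reply to s₁ and x the neighbour of s₁ on the path to d.
-- Against x, the part A holds no Staller vertex, and on the rest Dominator also owns
-- A ∋ d, which is at least as good for him as the reply d.
-- The argument runs in a monotone variant of the game, which has the same values.

module Submission where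

open import Defs
open import Data.Nat using (ℕ; zero; suc; _≤_; _<_; _≤′_; ≤′-refl; ≤′-step; _≤?_; s≤s; z≤n)
open import Data.Nat.Properties using (≤⇒≤′; ≰⇒>; n<1+n; <-cmp)
open import Data.Fin using (Fin; zero; suc; _≟_)
open import Data.Fin.Properties using (any?; all?; ¬∀⟶∃¬)
open import Data.Bool using (Bool; true; false; _∧_; _∨_; not)
open import Data.Bool.Properties using (∨-assoc; ∧-conicalˡ)
import Data.Bool.Properties as Bool
open import Data.Product using (Σ; ∃; _×_; _,_)
open import Data.Sum using (_⊎_; inj₁; inj₂; [_,_]′; map₂)
open import Data.Unit using (⊤)
open import Data.Empty using (⊥-elim)
open import Data.List using (List; []; _∷_; _++_; length)
open import Data.List.Relation.Unary.All as All using (All; []; _∷_)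
open import Data.List.Relation.Unary.All.Properties using (¬Any⇒All¬)
open import Data.List.Relation.Unary.AllPairs using ([]; _∷_)
open import Data.List.Relation.Unary.Linked using (Linked; [-]; _∷_)
open import Data.List.Relation.Unary.Unique.Propositional using (Unique)
open import Data.List.Membership.Propositional using (_∈_)
import Data.List.Membership.DecPropositional as DecMembership
open import Data.List.Relation.Unary.Any using (here; there)
open import Function using (_∘_; id)
open import Relation.Binary.Definitions using (tri<; tri≈; tri>)
open import Relation.Nullary using (¬_; Dec; yes; no; does; contradiction)
open import Relation.Nullary.Decidable
  using (dec-true; dec-false; _⊎-dec_; _×-dec_; _→-dec_; ¬¬-excluded-middle)
open import Relation.Binary.PropositionalEquality using (_≡_; _≢_; refl; sym; trans; cong; cong₂)

VertexSet : ℕ → Set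
VertexSet n = Fin n → Bool

≡true⇒≢false : ∀ {b} → b ≡ true → b ≢ false
≡true⇒≢false refl ()

¬¬-decidable : ∀ {n} (P : Fin n → Set) → ¬ ¬ (∀ u → Dec (P u))
¬¬-decidable {zero}  P ¬dec = ¬dec λ ()
¬¬-decidable {suc n} P ¬dec = ¬¬-excluded-middle λ P₀? →
  ¬¬-decidable (P ∘ suc) λ P₊? → ¬dec λ { zero → P₀? ; (suc u) → P₊? u }

module _ {n : ℕ} where

  infix  4 _⊆_
  infixr 7 _∩_
  infixr 6 _∪_

  _⊆_ : VertexSet n → VertexSet n → Set
  S ⊆ S′ = ∀ u → S u ≡ true → S′ u ≡ true

  _∩_ : VertexSet n → VertexSet n → VertexSet n
  (S ∩ R) u = S u ∧ R u

  _∪_ : VertexSet n → VertexSet n → VertexSet n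
  (S ∪ R) u = S u ∨ R u

  Disjoint : VertexSet n → VertexSet n → Set
  Disjoint S D = ∀ u → S u ≡ true → D u ≡ false

  Partition : VertexSet n → VertexSet n → Set
  Partition R Q = ∀ u → (R u ≡ true × Q u ≡ false) ⊎ (R u ≡ false × Q u ≡ true)

  Partition-sym : ∀ {R Q} → Partition R Q → Partition Q R
  Partition-sym p u = [ (λ (r , q) → inj₂ (q , r)) , (λ (r , q) → inj₁ (q , r)) ]′ (p u)

  ⊆-refl : ∀ {S} → S ⊆ S
  ⊆-refl _ e = e

  ∅-⊆ : ∀ {S} → ∅ ⊆ S
  ∅-⊆ _ ()

  ⊆-trans : ∀ {S S′ S″} → S ⊆ S′ → S′ ⊆ S″ → S ⊆ S″
  ⊆-trans S⊆S′ S′⊆S″ u = S′⊆S″ u ∘ S⊆S′ u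

  ⊆-∉ : ∀ {S S′} → S ⊆ S′ → ∀ u → S′ u ≡ false → S u ≡ false
  ⊆-∉ {S} S⊆S′ u S′u with S u in Su
  ... | false = refl
  ... | true  = contradiction S′u (≡true⇒≢false (S⊆S′ u Su))

  ∩-⊆ˡ : ∀ {S R} → S ∩ R ⊆ S
  ∩-⊆ˡ {S} u = ∧-conicalˡ (S u) _

  ∩-∉ˡ : ∀ {S R u} → R u ≡ true → (S ∩ R) u ≡ false → S u ≡ false
  ∩-∉ˡ {S} {u = u} Ru e with S u
  ... | false = refl
  ... | true  = contradiction e (≡true⇒≢false Ru)

  ∪-⊆ˡ : ∀ {S R} → S ⊆ S ∪ R
  ∪-⊆ˡ {S} u Su with S u
  ... | true = refl

  ∪-⊆ʳ : ∀ {S R} → R ⊆ S ∪ R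
  ∪-⊆ʳ {S} u Ru with S u
  ... | true  = refl
  ... | false = Ru

  ∪-monoˡ : ∀ {S S′ R} → S ⊆ S′ → S ∪ R ⊆ S′ ∪ R
  ∪-monoˡ {S} {S′} {R} S⊆S′ u e with S u in Su
  ... | true  = ∪-⊆ˡ {S′} {R} u (S⊆S′ u Su)
  ... | false = ∪-⊆ʳ {S′} {R} u e

  ⁅_⁆ : Fin n → VertexSet n
  ⁅ v ⁆ = insert v ∅

  insert-here : ∀ (v : Fin n) {S} → insert v S v ≡ true
  insert-here v rewrite dec-true (v ≟ v) refl = refl

  ⊆-insert : ∀ (v : Fin n) {S} → S ⊆ insert v S
  ⊆-insert v u Su with does (u ≟ v)
  ... | true  = refl
  ... | false = Su

  insert⁻ : ∀ {v : Fin n} {S} u → insert v S u ≡ true → u ≡ v ⊎ S u ≡ true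
  insert⁻ {v} u e with u ≟ v
  ... | yes u≡v = inj₁ u≡v
  ... | no  _   = inj₂ e

  ⁅⁆⁻ : ∀ {v u : Fin n} → ⁅ v ⁆ u ≡ true → u ≡ v
  ⁅⁆⁻ {u = u} e with insert⁻ u e
  ... | inj₁ u≡v = u≡v
  ... | inj₂ ()

  insert-∉ : ∀ {v : Fin n} {S u} → u ≢ v → S u ≡ false → insert v S u ≡ false
  insert-∉ {v} {S} {u} u≢v Su rewrite dec-false (u ≟ v) u≢v = Su

  insert-∉⇒≢ : ∀ {v : Fin n} {S u} → insert v S u ≡ false → u ≢ v
  insert-∉⇒≢ {v} {S} e refl = ≡true⇒≢false (insert-here v {S}) e

  insert-⊆ : ∀ {v : Fin n} {S S′} → S′ v ≡ true → S ⊆ S′ → insert v S ⊆ S′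
  insert-⊆ {v} {S} S′v S⊆S′ u e with insert⁻ {v} {S} u e
  ... | inj₁ refl = S′v
  ... | inj₂ Su   = S⊆S′ u Su

  insert-absorb : ∀ {v : Fin n} {S} → S v ≡ true → insert v S ⊆ S
  insert-absorb Sv = insert-⊆ Sv ⊆-refl

  insert-mono : ∀ (v : Fin n) {S S′} → S ⊆ S′ → insert v S ⊆ insert v S′
  insert-mono v {S} {S′} S⊆S′ =
    insert-⊆ {v} {S} (insert-here v {S′}) (λ u → ⊆-insert v {S′} u ∘ S⊆S′ u)

  insert-∩ : ∀ {v : Fin n} {S R} → insert v S ∩ R ⊆ insert v (S ∩ R)
  insert-∩ {v} u e with does (u ≟ v)
  ... | true  = refl
  ... | false = e

  insert-∩-∉ : ∀ {v : Fin n} {S R} → R v ≡ false → insert v S ∩ R ⊆ S ∩ R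
  insert-∩-∉ {v} Rv u e with u ≟ v
  ... | yes refl = contradiction Rv (≡true⇒≢false e)
  ... | no  _    = e

  insert-∪ : ∀ {v : Fin n} {D Q} → insert v (D ∪ Q) ⊆ insert v D ∪ Q
  insert-∪ {v} {D} {Q} u e = trans (∨-assoc (does (u ≟ v)) (D u) (Q u)) e

  Disjoint-insertˡ : ∀ {v : Fin n} {S D} → Disjoint S D → D v ≡ false → Disjoint (insert v S) D
  Disjoint-insertˡ {v} {S} S#D Dv u e with insert⁻ {v} {S} u e
  ... | inj₁ refl = Dv
  ... | inj₂ Su   = S#D u Su

  Disjoint-insertʳ : ∀ {v : Fin n} {S D} → Disjoint S D → S v ≡ false → Disjoint S (insert v D)
  Disjoint-insertʳ {v} {S} {D} S#D Sv u Su =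
    insert-∉ {v} {D} (λ { refl → ≡true⇒≢false Su Sv }) (S#D u Su)

  ⁅⁆-disjoint : ∀ {v w : Fin n} → v ≢ w → Disjoint ⁅ v ⁆ ⁅ w ⁆
  ⁅⁆-disjoint v≢w = Disjoint-insertˡ (λ _ ()) (insert-∉ v≢w refl)

module _ {n : ℕ} (G : Graph n) where

  Adj-sym : ∀ {u v} → Adj G u v → Adj G v u
  Adj-sym {u} {v} e = trans (E-sym G v u) e

  Adj⇒≢ : ∀ {u v} → Adj G u v → u ≢ v
  Adj⇒≢ {u} e refl = ≡true⇒≢false e (E-irr G u)

  SplitsNbhds : VertexSet n → VertexSet n → VertexSet n → Set
  SplitsNbhds R Q D = ∀ w → (∀ u → InClosedNbhd G w u → D u ≡ false) →
    (∀ u → InClosedNbhd G w u → R u ≡ true) ⊎ (∀ u → InClosedNbhd G w u → Q u ≡ true)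

  SplitsNbhds-sym : ∀ {R Q D} → SplitsNbhds R Q D → SplitsNbhds Q R D
  SplitsNbhds-sym sp w N[w]#D = [ inj₂ , inj₁ ]′ (sp w N[w]#D)

  SplitsNbhds-antitone : ∀ {R Q D D′} → SplitsNbhds R Q D → D ⊆ D′ → SplitsNbhds R Q D′
  SplitsNbhds-antitone sp D⊆D′ w N[w]#D′ = sp w λ u u∈N[w] → ⊆-∉ D⊆D′ u (N[w]#D′ u u∈N[w])

  module _ {P : Fin n → Set} where

    Walk-head : ∀ {u v} → Walk G P u v → P u
    Walk-head (stop p)     = p
    Walk-head (step p _ _) = p

    Walk-last : ∀ {u v} → Walk G P u v → P v
    Walk-last (stop p)     = p
    Walk-last (step _ _ r) = Walk-last r

    snoc : ∀ {u v w} → Walk G P u v → Adj G v w → P w → Walk G P u w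
    snoc (stop p)     e Pw = step p e (stop Pw)
    snoc (step p e r) e′ Pw = step p e (snoc r e′ Pw)

    reverse : ∀ {u v} → Walk G P u v → Walk G P v u
    reverse (stop p)     = stop p
    reverse (step p e r) = snoc (reverse r) (Adj-sym e) p

    vertices : ∀ {u v} → Walk G P u v → List (Fin n)
    vertices {u} (stop _)     = u ∷ []
    vertices {u} (step _ _ r) = u ∷ vertices r

    vertices-All : ∀ {u v} (r : Walk G P u v) → All P (vertices r)
    vertices-All (stop p)     = p ∷ []
    vertices-All (step p _ r) = p ∷ vertices-All r

    vertices-Linked : ∀ {u v w} (r : Walk G P u v) → Adj G v w →
                      Linked (Adj G) (vertices r ++ w ∷ [])
    vertices-Linked (stop _)                 e  = e ∷ [-]
    vertices-Linked (step _ e (stop _))      e′ = e ∷ e′ ∷ [-]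
    vertices-Linked (step _ e r@(step _ _ _)) e′ = e ∷ vertices-Linked r e′

    Path : Fin n → Fin n → Set
    Path u v = Σ (Walk G P u v) (Unique ∘ vertices)

    open DecMembership (_≟_ {n}) using (_∈?_)

    suffix : ∀ {u v w} (r : Walk G P u v) → Unique (vertices r) → w ∈ vertices r → Path w v
    suffix r@(stop _)     uniq       (here refl) = r , uniq
    suffix r@(step _ _ _) uniq       (here refl) = r , uniq
    suffix (step _ _ r)   (_ ∷ uniq) (there w∈r) = suffix r uniq w∈r

    toPath : ∀ {u v} → Walk G P u v → Path u v
    toPath (stop p) = stop p , [] ∷ []
    toPath {u} (step p e r) with toPath r
    ... | r′ , uniq with u ∈? vertices r′
    ...   | yes u∈r′ = suffix r′ uniq u∈r′
    ...   | no  u∉r′ = step p e r′ , ¬Any⇒All¬ (vertices r′) u∉r′ ∷ uniq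

  Acyclic⇒neighbours-separated : Acyclic G → ∀ {s x w} → Adj G s x → Adj G w s → x ≢ w →
                                 ¬ Walk G (_≢ s) x w
  Acyclic⇒neighbours-separated acyclic {s} s~x w~s x≢w x⇝w with toPath x⇝w
  ... | stop _ , _ = x≢w refl
  ... | r@(step _ _ r′) , uniq =
    acyclic (s ∷ vertices r) ((All.map (λ u≢s s≡u → u≢s (sym s≡u)) (vertices-All r) ∷ uniq)
                             , s≤s (s≤s (length-vertices r′))
                             , s~x ∷ vertices-Linked r w~s)
    where
    length-vertices : ∀ {u v} (q : Walk G (_≢ s) u v) → 1 ≤ length (vertices q)
    length-vertices (stop _)     = s≤s z≤n
    length-vertices (step _ _ _) = s≤s z≤n

  neighbour-towards : ∀ {s d} → Walk G (λ _ → ⊤) s d → d ≢ s → ∃ λ x → Adj G s x × Walk G (_≢ s) x d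
  neighbour-towards {s} {d} r d≢s = [ (λ s⇝d → ⊥-elim (Walk-head s⇝d refl)) , id ]′ (last-exit r)
    where
    last-exit : ∀ {u} → Walk G (λ _ → ⊤) u d →
                Walk G (_≢ s) u d ⊎ ∃ λ x → Adj G s x × Walk G (_≢ s) x d
    last-exit (stop _) = inj₁ (stop d≢s)
    last-exit {u} (step _ e r) with last-exit r | u ≟ s
    ... | inj₂ exit | _        = inj₂ exit
    ... | inj₁ r′   | yes refl = inj₂ (_ , e , r′)
    ... | inj₁ r′   | no  u≢s  = inj₁ (step u≢s e r′)

  module Component (acyclic : Acyclic G) {s x : Fin n} (s~x : Adj G s x)
                   (reach? : ∀ u → Dec (Walk G (_≢ s) x u)) where

    A : VertexSet n
    A u = does (reach? u)

    Aᶜ : VertexSet n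
    Aᶜ u = not (A u)

    A-reach : ∀ {u} → Walk G (_≢ s) x u → A u ≡ true
    A-reach {u} = dec-true (reach? u)

    Aᶜ-reach : ∀ {u} → Walk G (_≢ s) x u → Aᶜ u ≡ false
    Aᶜ-reach = cong not ∘ A-reach

    Aᶜ-unreach : ∀ {u} → ¬ Walk G (_≢ s) x u → Aᶜ u ≡ true
    Aᶜ-unreach {u} = cong not ∘ dec-false (reach? u)

    s∉A : A s ≡ false
    s∉A = dec-false (reach? s) λ x⇝s → Walk-last x⇝s refl

    partition : Partition A Aᶜ
    partition u with A u
    ... | true  = inj₁ (refl , refl)
    ... | false = inj₂ (refl , refl)

    x∉N[_] : ∀ w → (∀ u → InClosedNbhd G w u → ⁅ x ⁆ u ≡ false) → ¬ InClosedNbhd G w x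
    x∉N[ w ] N[w]#x x∈N[w] = ≡true⇒≢false (insert-here x) (N[w]#x x x∈N[w])

    -- In a tree only N[s] meets both A and its complement, and N[s] contains x.
    splits : SplitsNbhds A Aᶜ ⁅ x ⁆
    splits w N[w]#x with reach? w
    ... | yes x⇝w = inj₁ N[w]⊆A
      where
      N[w]⊆A : ∀ u → InClosedNbhd G w u → A u ≡ true
      N[w]⊆A u (inj₁ refl) = A-reach x⇝w
      N[w]⊆A u (inj₂ u~w) with u ≟ s
      ... | yes refl = ⊥-elim (Acyclic⇒neighbours-separated acyclic s~x (Adj-sym u~w)
                                 (x∉N[ w ] N[w]#x ∘ inj₁) x⇝w)
      ... | no  u≢s  = A-reach (snoc x⇝w (Adj-sym u~w) u≢s)
    ... | no ¬x⇝w = inj₂ N[w]⊆Aᶜ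
      where
      w≢s : w ≢ s
      w≢s refl = x∉N[ w ] N[w]#x (inj₂ (Adj-sym s~x))
      N[w]⊆Aᶜ : ∀ u → InClosedNbhd G w u → Aᶜ u ≡ true
      N[w]⊆Aᶜ u (inj₁ refl) = Aᶜ-unreach ¬x⇝w
      N[w]⊆Aᶜ u (inj₂ u~w) = Aᶜ-unreach λ x⇝u → ¬x⇝w (snoc x⇝u u~w w≢s)

module MonotoneGame {n : ℕ} (T : Graph n) where

  Won : VertexSet n → Set
  Won S = ∃ λ v → ∀ u → InClosedNbhd T v u → S u ≡ true

  won? : ∀ S → Dec (Won S)
  won? S = any? λ v → all? λ u →
    ((u ≟ v) ⊎-dec (E T u v Bool.≟ true)) →-dec (S u Bool.≟ true)

  Won-mono : ∀ {S S′} → S ⊆ S′ → Won S → Won S′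
  Won-mono S⊆S′ (v , N[v]⊆S) = v , λ u u∈N[v] → S⊆S′ u (N[v]⊆S u u∈N[v])

  ¬Won-∅ : ¬ Won ∅
  ¬Won-∅ (v , N[v]⊆∅) with () ← N[v]⊆∅ v (inj₁ refl)

  ¬Won-⁅⁆ : ∀ {s y} → Adj T s y → ¬ Won ⁅ s ⁆
  ¬Won-⁅⁆ {s} {y} s~y (v , N[v]⊆s) with ⁅⁆⁻ {v = s} {u = v} (N[v]⊆s v (inj₁ refl))
  ... | refl = Adj⇒≢ T s~y (sym (⁅⁆⁻ {v = s} {u = y} (N[v]⊆s y (inj₂ (Adj-sym T s~y)))))

  ¬Won⇒∃∉ : Fin n → ∀ {S} → ¬ Won S → ∃ λ u → S u ≡ false
  ¬Won⇒∃∉ x₀ {S} ¬won with any? (λ u → S u Bool.≟ false)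
  ... | yes ∃∉ = ∃∉
  ... | no  ∄∉ = contradiction (x₀ , λ u _ → Bool.¬-not λ Su → ∄∉ (u , Su)) ¬won

  ¬Won-sum : ∀ {R Q S D} → SplitsNbhds T R Q D → Disjoint S D →
             ¬ Won (S ∩ R) → ¬ Won (S ∩ Q) → ¬ Won S
  ¬Won-sum sp S#D ¬wonR ¬wonQ (w , N[w]⊆S) with sp w (λ u u∈N[w] → S#D u (N[w]⊆S u u∈N[w]))
  ... | inj₁ N[w]⊆R = ¬wonR (w , λ u u∈N[w] → cong₂ _∧_ (N[w]⊆S u u∈N[w]) (N[w]⊆R u u∈N[w]))
  ... | inj₂ N[w]⊆Q = ¬wonQ (w , λ u u∈N[w] → cong₂ _∧_ (N[w]⊆S u u∈N[w]) (N[w]⊆Q u u∈N[w]))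

  -- The monotone game: Staller may also pass or re-claim one of her vertices, and
  -- Dominator may re-claim one of his.  Unlike the real game it is monotone in the
  -- two sets (SWin⁺-mono), and it agrees with the real game on disjoint positions.
  mutual
    SWin⁺ : ℕ → VertexSet n → VertexSet n → Set
    SWin⁺ zero    S D = Won S
    SWin⁺ (suc k) S D = DWin⁺ k S D ⊎ (∃ λ v → D v ≡ false × DWin⁺ k (insert v S) D)

    DWin⁺ : ℕ → VertexSet n → VertexSet n → Set
    DWin⁺ k S D = Won S ⊎ (∀ u → S u ≡ false → SWin⁺ k S (insert u D))

  mutual
    SWin⁺? : ∀ k S D → Dec (SWin⁺ k S D)
    SWin⁺? zero    S D = won? S
    SWin⁺? (suc k) S D =
      DWin⁺? k S D ⊎-dec any? λ v → (D v Bool.≟ false) ×-dec DWin⁺? k (insert v S) D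

    DWin⁺? : ∀ k S D → Dec (DWin⁺ k S D)
    DWin⁺? k S D = won? S ⊎-dec all? λ u → (S u Bool.≟ false) →-dec SWin⁺? k S (insert u D)

  mutual
    SWin⁺-mono : ∀ k {S S′ D D′} → S ⊆ S′ → D′ ⊆ D → SWin⁺ k S D → SWin⁺ k S′ D′
    SWin⁺-mono zero    S⊆S′ _     = Won-mono S⊆S′
    SWin⁺-mono (suc k) S⊆S′ D′⊆D (inj₁ dw) = inj₁ (DWin⁺-mono k S⊆S′ D′⊆D dw)
    SWin⁺-mono (suc k) S⊆S′ D′⊆D (inj₂ (v , Dv , dw)) =
      inj₂ (v , ⊆-∉ D′⊆D v Dv , DWin⁺-mono k (insert-mono v S⊆S′) D′⊆D dw)

    DWin⁺-mono : ∀ k {S S′ D D′} → S ⊆ S′ → D′ ⊆ D → DWin⁺ k S D → DWin⁺ k S′ D′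
    DWin⁺-mono k S⊆S′ D′⊆D (inj₁ won) = inj₁ (Won-mono S⊆S′ won)
    DWin⁺-mono k S⊆S′ D′⊆D (inj₂ f)   =
      inj₂ λ u S′u → SWin⁺-mono k S⊆S′ (insert-mono u D′⊆D) (f u (⊆-∉ S⊆S′ u S′u))

  mutual
    SWin⁺-suc : ∀ k {S D} → SWin⁺ k S D → SWin⁺ (suc k) S D
    SWin⁺-suc zero    won                  = inj₁ (inj₁ won)
    SWin⁺-suc (suc k) (inj₁ dw)            = inj₁ (DWin⁺-suc k dw)
    SWin⁺-suc (suc k) (inj₂ (v , Dv , dw)) = inj₂ (v , Dv , DWin⁺-suc k dw)

    DWin⁺-suc : ∀ k {S D} → DWin⁺ k S D → DWin⁺ (suc k) S D
    DWin⁺-suc k (inj₁ won) = inj₁ won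
    DWin⁺-suc k (inj₂ f)   = inj₂ λ u Su → SWin⁺-suc k (f u Su)

  SWin⁺-≤ : ∀ {j k S D} → j ≤ k → SWin⁺ j S D → SWin⁺ k S D
  SWin⁺-≤ = go ∘ ≤⇒≤′
    where
    go : ∀ {j k S D} → j ≤′ k → SWin⁺ j S D → SWin⁺ k S D
    go ≤′-refl         = id
    go (≤′-step j≤′k) = SWin⁺-suc _ ∘ go j≤′k

  Won⇒SWin⁺ : ∀ k {S D} → Won S → SWin⁺ k S D
  Won⇒SWin⁺ k = SWin⁺-≤ z≤n

  DWin⁺-reply : ∀ k {S D u} → ¬ Won S → DWin⁺ k S D → S u ≡ false → SWin⁺ k S (insert u D)
  DWin⁺-reply k ¬won (inj₁ won) _  = contradiction won ¬won
  DWin⁺-reply k ¬won (inj₂ f)   Su = f _ Su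

  ¬DWin⁺-reply : ∀ k {S D} → ¬ DWin⁺ k S D →
                 ¬ Won S × ∃ λ u → S u ≡ false × ¬ SWin⁺ k S (insert u D)
  ¬DWin⁺-reply k {S} {D} ¬dw with ¬∀⟶∃¬ n _ (λ u → (S u Bool.≟ false) →-dec SWin⁺? k S (insert u D))
                                           (¬dw ∘ inj₂)
  ... | u , ¬reply with S u Bool.≟ false
  ...   | yes Su = ¬dw ∘ inj₁ , u , Su , ¬reply ∘ λ sw _ → sw
  ...   | no  Su = contradiction (λ Su′ → contradiction Su′ Su) ¬reply

  mutual
    SWin⇒SWin⁺ : ∀ k p → SWin T k p → SWin⁺ k (St p) (Dm p)
    SWin⇒SWin⁺ (suc k) p (v , (_ , Dv) , dw) = inj₂ (v , Dv , DWin⇒DWin⁺ k (playS v p) dw)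

    DWin⇒DWin⁺ : ∀ k p → DWin T k p → DWin⁺ k (St p) (Dm p)
    DWin⇒DWin⁺ k p (inj₁ won) = inj₁ won
    DWin⇒DWin⁺ k p (inj₂ ((u₀ , free₀) , f)) = inj₂ reply
      where
      reply : ∀ u → St p u ≡ false → SWin⁺ k (St p) (insert u (Dm p))
      reply u Su with Dm p u in Du
      ... | false = SWin⇒SWin⁺ k (playD u p) (f u (Su , Du))
      ... | true  = SWin⁺-mono k ⊆-refl (insert-⊆ (⊆-insert u₀ {Dm p} u Du) (⊆-insert u₀))
                      (SWin⇒SWin⁺ k (playD u₀ p) (f u₀ free₀))

  Full : VertexSet n → VertexSet n → Set
  Full S D = ∀ u → S u ≡ true ⊎ D u ≡ true

  free-or-full : ∀ S D → (∃ λ u → S u ≡ false × D u ≡ false) ⊎ Full S D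
  free-or-full S D with any? (λ u → (S u Bool.≟ false) ×-dec (D u Bool.≟ false))
  ... | yes free = inj₁ free
  ... | no  full = inj₂ λ u → occupied u
    where
    occupied : ∀ u → S u ≡ true ⊎ D u ≡ true
    occupied u with S u in Su | D u in Du
    ... | true  | _     = inj₁ refl
    ... | false | true  = inj₂ refl
    ... | false | false = contradiction (u , Su , Du) full

  -- The vertex x₀ only witnesses that the board is nonempty: on the empty board
  -- Dominator has no move, so the monotone game counts as won by Staller.
  mutual
    Full⇒¬SWin⁺ : Fin n → ∀ k {S D} → Full S D → ¬ Won S → ¬ SWin⁺ k S D
    Full⇒¬SWin⁺ x₀ zero    full ¬won = ¬won
    Full⇒¬SWin⁺ x₀ (suc k) full ¬won (inj₁ dw) = Full⇒¬DWin⁺ x₀ k full ¬won dw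
    Full⇒¬SWin⁺ x₀ (suc k) {S} full ¬won (inj₂ (v , Dv , dw)) with full v
    ... | inj₁ Sv  = Full⇒¬DWin⁺ x₀ k full ¬won (DWin⁺-mono k (insert-absorb {S = S} Sv) ⊆-refl dw)
    ... | inj₂ Dv′ = ≡true⇒≢false Dv′ Dv

    Full⇒¬DWin⁺ : Fin n → ∀ k {S D} → Full S D → ¬ Won S → ¬ DWin⁺ k S D
    Full⇒¬DWin⁺ x₀ k full ¬won (inj₁ won) = ¬won won
    Full⇒¬DWin⁺ x₀ k {D = D} full ¬won (inj₂ f) with ¬Won⇒∃∉ x₀ ¬won
    ... | u , Su = Full⇒¬SWin⁺ x₀ k (λ v → map₂ (⊆-insert u {D} v) (full v)) ¬won (f u Su)

  mutual
    SWin⁺⇒SWin : Fin n → ∀ k {S D} → Disjoint S D → ¬ Won S → SWin⁺ k S D → SWin T k ⟨ S , D ⟩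
    SWin⁺⇒SWin x₀ zero    S#D ¬won won = contradiction won ¬won
    SWin⁺⇒SWin x₀ (suc k) S#D ¬won (inj₁ dw) = claim-free x₀ k S#D ¬won dw
    SWin⁺⇒SWin x₀ (suc k) {S} S#D ¬won (inj₂ (v , Dv , dw)) with S v in Sv
    ... | false = v , (Sv , Dv) , DWin⁺⇒DWin x₀ k (Disjoint-insertˡ S#D Dv) dw
    ... | true  = claim-free x₀ k S#D ¬won (DWin⁺-mono k (insert-absorb {S = S} Sv) ⊆-refl dw)

    claim-free : Fin n → ∀ k {S D} → Disjoint S D → ¬ Won S → DWin⁺ k S D → SWin T (suc k) ⟨ S , D ⟩
    claim-free x₀ k {S} {D} S#D ¬won dw with free-or-full S D
    ... | inj₁ (v , Sv , Dv) =
      v , (Sv , Dv) ,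
      DWin⁺⇒DWin x₀ k (Disjoint-insertˡ S#D Dv) (DWin⁺-mono k (⊆-insert v) ⊆-refl dw)
    ... | inj₂ full = contradiction dw (Full⇒¬DWin⁺ x₀ k full ¬won)

    DWin⁺⇒DWin : Fin n → ∀ k {S D} → Disjoint S D → DWin⁺ k S D → DWin T k ⟨ S , D ⟩
    DWin⁺⇒DWin x₀ k S#D (inj₁ won) = inj₁ won
    DWin⁺⇒DWin x₀ k {S} {D} S#D (inj₂ f) with won? S
    ... | yes won = inj₁ won
    ... | no ¬won with free-or-full S D
    ...   | inj₁ free = inj₂ (free , λ u (Su , _) →
                         SWin⁺⇒SWin x₀ k (Disjoint-insertʳ S#D Su) ¬won (f u Su))
    ...   | inj₂ full = contradiction (inj₂ f) (Full⇒¬DWin⁺ x₀ k full ¬won)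

  claim-in-part : ∀ k {v S D R Q} → D v ≡ false → Q v ≡ false →
                  DWin⁺ k (insert v S ∩ R) (D ∪ Q) → SWin⁺ (suc k) (S ∩ R) (D ∪ Q)
  claim-in-part k {v} {S} {R = R} Dv Qv dw =
    inj₂ (v , cong₂ _∨_ Dv Qv , DWin⁺-mono k (insert-∩ {v = v} {S = S} {R = R}) ⊆-refl dw)

  reply-in-part : ∀ {R Q S D : VertexSet n} {u} → Partition R Q → (S ∩ R) u ≡ false →
                  ∃ (λ w → S w ≡ false) →
                  ∃ λ u′ → S u′ ≡ false × insert u (D ∪ Q) ⊆ insert u′ D ∪ Q
  reply-in-part {R} {Q} {S} {D} {u} p SRu (w , Sw) with p u
  ... | inj₁ (Ru , _) = u , ∩-∉ˡ {S = S} {R = R} Ru SRu , insert-∪ {v = u} {D = D} {Q = Q}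
  ... | inj₂ (_ , Qu) =
    w , Sw , insert-⊆ (∪-⊆ʳ {S = insert w D} {R = Q} u Qu) (∪-monoˡ (⊆-insert w))

  -- Dominator answers in the part where Staller has just moved.  If that part's game
  -- answers outside the part, where it already credits him with every vertex, the
  -- answer is in effect a pass, and on the whole board he claims any vertex instead.
  mutual
    ¬SWin⁺-sum : ∀ {R Q} → Partition R Q → ∀ k {S D} → SplitsNbhds T R Q D → Disjoint S D →
                 ¬ SWin⁺ k (S ∩ R) (D ∪ Q) → ¬ SWin⁺ k (S ∩ Q) (D ∪ R) → ¬ SWin⁺ k S D
    ¬SWin⁺-sum p zero sp S#D ¬R ¬Q = ¬Won-sum sp S#D ¬R ¬Q
    ¬SWin⁺-sum p (suc k) sp S#D ¬R ¬Q (inj₁ dw) =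
      ¬DWin⁺-sum p k sp S#D (¬R ∘ inj₁) (¬Q ∘ SWin⁺-suc k) dw
    ¬SWin⁺-sum {R} {Q} p (suc k) {S} {D} sp S#D ¬R ¬Q (inj₂ (v , Dv , dw)) with p v
    ... | inj₁ (_ , Qv) =
      ¬DWin⁺-sum p k sp (Disjoint-insertˡ S#D Dv) (¬R ∘ claim-in-part k {D = D} {Q = Q} Dv Qv)
        (¬Q ∘ SWin⁺-suc k ∘ SWin⁺-mono k (insert-∩-∉ {v = v} {S = S} Qv) ⊆-refl) dw
    ... | inj₂ (Rv , _) =
      ¬DWin⁺-sum (Partition-sym p) k (SplitsNbhds-sym T sp) (Disjoint-insertˡ S#D Dv)
        (¬Q ∘ claim-in-part k {D = D} {Q = R} Dv Rv)
        (¬R ∘ SWin⁺-suc k ∘ SWin⁺-mono k (insert-∩-∉ {v = v} {S = S} Rv) ⊆-refl) dw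

    ¬DWin⁺-sum : ∀ {R Q} → Partition R Q → ∀ k {S D} → SplitsNbhds T R Q D → Disjoint S D →
                 ¬ DWin⁺ k (S ∩ R) (D ∪ Q) → ¬ SWin⁺ k (S ∩ Q) (D ∪ R) → ¬ DWin⁺ k S D
    ¬DWin⁺-sum p k sp S#D ¬R ¬Q (inj₁ won) =
      ¬Won-sum sp S#D (¬R ∘ inj₁) (¬Q ∘ Won⇒SWin⁺ k) won
    ¬DWin⁺-sum p k {S} {D} sp S#D ¬R ¬Q (inj₂ f) with ¬DWin⁺-reply k ¬R
    ... | ¬wonR , u , SRu , ¬R′
        with reply-in-part {D = D} p SRu (¬Won⇒∃∉ u (¬Won-sum sp S#D ¬wonR (¬Q ∘ Won⇒SWin⁺ k)))
    ...   | u′ , Su′ , reply⊆ =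
      ¬SWin⁺-sum p k (SplitsNbhds-antitone T sp (⊆-insert u′)) (Disjoint-insertʳ S#D Su′)
        (¬R′ ∘ SWin⁺-mono k ⊆-refl reply⊆) (¬Q ∘ SWin⁺-mono k ⊆-refl (∪-monoˡ (⊆-insert u′)))
        (f u′ Su′)

module _ {n : ℕ} (T : Graph n) (acyclic : Acyclic T) where
  open MonotoneGame T

  ¬DWin⁺-move-in-reply-component :
    ∀ k {s d s₂} → Adj T s d → ¬ SWin⁺ (suc k) ∅ ∅ → ¬ SWin⁺ k ⁅ s ⁆ ⁅ d ⁆ →
    ⁅ d ⁆ s₂ ≡ false → Walk T (_≢ s) s₂ d → ¬ DWin⁺ k (insert s₂ ⁅ s ⁆) ⁅ d ⁆
  ¬DWin⁺-move-in-reply-component k {s} {d} {s₂} s~d ¬SW₀ ¬SW₁ d≢s₂ s₂⇝d dw =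
    ¬¬-decidable (Walk T (_≢ s) d) λ reach? →
      let open Component T acyclic s~d reach? in
      ¬DWin⁺-sum partition k splits (Disjoint-insertˡ (⁅⁆-disjoint (Adj⇒≢ T s~d)) d≢s₂)
        (λ dwA → ¬SW₀ (inj₂ (s₂ , refl ,
           DWin⁺-mono k (⊆-trans insert-∩ (insert-mono s₂ (insert-∩-∉ s∉A))) ∅-⊆ dwA)))
        (¬SW₁ ∘ SWin⁺-mono k (⊆-trans (insert-∩-∉ (Aᶜ-reach (reverse T s₂⇝d))) ∩-⊆ˡ) ∪-⊆ˡ)
        dw

  ¬SWin⁺-neighbour-towards-reply :
    ∀ k {s x d} → Adj T s x → ¬ SWin⁺ (suc k) ∅ ∅ → ¬ SWin⁺ k ⁅ s ⁆ ⁅ d ⁆ →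
    Walk T (_≢ s) x d → ¬ SWin⁺ k ⁅ s ⁆ ⁅ x ⁆
  ¬SWin⁺-neighbour-towards-reply k {s} {x} {d} s~x ¬SW₀ ¬SW₁ x⇝d sw =
    ¬¬-decidable (Walk T (_≢ s) x) λ reach? →
      let open Component T acyclic s~x reach? in
      ¬SWin⁺-sum partition k splits (⁅⁆-disjoint (Adj⇒≢ T s~x))
        (¬SW₀ ∘ SWin⁺-suc k ∘ SWin⁺-mono k (insert-∩-∉ s∉A) ∅-⊆)
        (¬SW₁ ∘ SWin⁺-mono k ∩-⊆ˡ (insert-⊆ (∪-⊆ʳ {S = ⁅ x ⁆} {R = A} d (A-reach x⇝d)) ∅-⊆))
        sw

  neighbour-reply : Connected T → ∀ k s → ¬ SWin⁺ (suc k) ∅ ∅ →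
                    ∃ λ x → Adj T s x × ¬ SWin⁺ k ⁅ s ⁆ ⁅ x ⁆
  neighbour-reply connected k s ¬SW₀ with ¬DWin⁺-reply k (λ dw → ¬SW₀ (inj₂ (s , refl , dw)))
  ... | _ , d , ⁅s⁆d , ¬SW₁ with neighbour-towards T (connected s d) (insert-∉⇒≢ ⁅s⁆d)
  ... | x , s~x , x⇝d = x , s~x , ¬SWin⁺-neighbour-towards-reply k s~x ¬SW₀ ¬SW₁ x⇝d

IsSVal-unique : ∀ {n} (T : Graph n) {p a b} → IsSVal T p a → IsSVal T p b → a ≡ b
IsSVal-unique T {a = a} {b} (SWa , minimalA) (SWb , minimalB) with <-cmp a b
... | tri< a<b _ _ = contradiction SWa (minimalB a a<b)
... | tri≈ _ a≡b _ = a≡b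
... | tri> _ _ b<a = contradiction SWb (minimalA b b<a)

module _ {n : ℕ} (T : Graph n) where
  open MonotoneGame T

  ¬SWin⁺-below-γ : Fin n → ∀ {k} → IsGammaSMB' T (suc k) → ¬ SWin⁺ k ∅ ∅
  ¬SWin⁺-below-γ x₀ {k} (_ , minimal) = minimal k (n<1+n k) ∘ SWin⁺⇒SWin x₀ k (λ _ ()) ¬Won-∅

  optimal-second-move-outside-reply-component :
    Acyclic T → ∀ {k₀ s₁} → ¬ SWin⁺ k₀ ∅ ∅ → DWin T k₀ (playS s₁ start) →
    ∀ d₁ → Adj T s₁ d₁ → ∀ s₂ → OptS T (playD d₁ (playS s₁ start)) s₂ →
    ¬ SameComponentWithout T s₁ s₂ d₁
  optimal-second-move-outside-reply-component acyclic {k₀} {s₁} ¬SW₀ dw₀ d₁ s₁~d₁ s₂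
    ((_ , d₁≢s₂) , k , (_ , minimal) , dw) s₂⇝d₁ =
    ¬DWin⁺-move-in-reply-component T acyclic k s₁~d₁ (¬SW₀ ∘ SWin⁺-≤ k<k₀) ¬SW₁ d₁≢s₂ s₂⇝d₁
      (DWin⇒DWin⁺ k _ dw)
    where
    ¬SW₁ : ¬ SWin⁺ k ⁅ s₁ ⁆ ⁅ d₁ ⁆
    ¬SW₁ = minimal k (n<1+n k) ∘ SWin⁺⇒SWin s₁ k (⁅⁆-disjoint (Adj⇒≢ T s₁~d₁)) (¬Won-⁅⁆ s₁~d₁)

    SW₁ : SWin⁺ k₀ ⁅ s₁ ⁆ ⁅ d₁ ⁆
    SW₁ = DWin⁺-reply k₀ (¬Won-⁅⁆ s₁~d₁) (DWin⇒DWin⁺ k₀ _ dw₀) (insert-∉ (Adj⇒≢ T s₁~d₁ ∘ sym) refl)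

    k<k₀ : suc k ≤ k₀
    k<k₀ with k₀ ≤? k
    ... | yes k₀≤k = contradiction (SWin⁺-≤ k₀≤k SW₁) ¬SW₁
    ... | no  k₀≰k = ≰⇒> k₀≰k

  optimal-neighbour-reply :
    IsTree T → ∀ {k₁ s₁} → IsGammaSMB' T (suc (suc k₁)) → Free start s₁ →
    DWin T (suc k₁) (playS s₁ start) → ∃ λ d₁′ → Adj T s₁ d₁′ × OptD T (playS s₁ start) d₁′
  optimal-neighbour-reply (connected , acyclic) {k₁} {s₁} γ@(_ , minimal) free₁ dw₀
    with neighbour-reply T acyclic connected k₁ s₁ (¬SWin⁺-below-γ s₁ γ)
  ... | x , s₁~x , ¬SW₁ = x , s₁~x , free-x , suc k₁ , (dw₀ , minimalD) , (SW₁ , minimalS)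
    where
    free-x : Free (playS s₁ start) x
    free-x = insert-∉ (Adj⇒≢ T s₁~x ∘ sym) refl , refl

    minimalD : ∀ j → j < suc k₁ → ¬ DWin T j (playS s₁ start)
    minimalD j j<k₀ dw = minimal (suc j) (s≤s j<k₀) (s₁ , free₁ , dw)

    SW₁ : SWin T (suc k₁) (playD x (playS s₁ start))
    SW₁ = [ (λ won → contradiction won (¬Won-⁅⁆ s₁~x)) , (λ (_ , reply) → reply x free-x) ]′ dw₀

    minimalS : ∀ j → j < suc k₁ → ¬ SWin T j (playD x (playS s₁ start))
    minimalS j (s≤s j≤k₁) = ¬SW₁ ∘ SWin⁺-≤ j≤k₁ ∘ SWin⇒SWin⁺ j _

lemma9 : ∀ {n} (T : Graph n) → IsTree T → (m : ℕ) → IsGammaSMB' T m → 2 ≤ m →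
         (s₁ : Fin n) → OptS T start s₁ →
         ((∀ d₁ → Free (playS s₁ start) d₁ → Adj T s₁ d₁ →
             ∀ s₂ → OptS T (playD d₁ (playS s₁ start)) s₂ →
             ¬ SameComponentWithout T s₁ s₂ d₁)
         × (∃ λ d₁′ → Adj T s₁ d₁′ × OptD T (playS s₁ start) d₁′))
lemma9 T tree m γ 2≤m s₁ (free₁ , k₀ , val₀ , dw₀) with IsSVal-unique T γ val₀
lemma9 T _ _ _ (s≤s ()) _ (_ , zero , _) | refl
lemma9 T tree@(_ , acyclic) _ γ _ s₁ (free₁ , suc _ , _ , dw₀) | refl =
    (λ d₁ _ → optimal-second-move-outside-reply-component T acyclic (¬SWin⁺-below-γ T s₁ γ) dw₀ d₁)
  , optimal-neighbour-reply T tree γ free₁ dw₀
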